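{- Let $p$ be a prime, $s,m$ positive integers, $q=p^s$, $r=q^m$, and let $\alpha$ be a generator of the multiplicative group $\mathrm{GF}(r)^*$. Let $h$ be a positive divisor of $q-1$ and let $e>1$ be an integer with $e \mid \gcd(q-1,hm)$. Put $g=\alpha^{(q-1)/h}$, $n=\frac{h(r-1)}{q-1}$ and $\beta=\alpha^{(r-1)/e}$. Then the multiplicative order of $g$ is $n$, $(g\beta)^n=1$, and the minimal polynomials of $g^{ -1}$ and $(\beta g)^{ -1}$ over $\mathrm{GF}(q)$ are distinct, except when $q=3$, $h=1$ and $e=m=2$. -}

module Defs where

open import Level using (Level; _⊔_) renaming (suc to lsuc)
open import Data.Nat using (ℕ; zero; suc; _≤_; _<_)
open import Data.Fin using (Fin)
open import Data.List using (List; []; _∷_; length)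
open import Data.List.Relation.Unary.All using (All)
open import Data.Product using (_×_; ∃)
open import Data.Empty using (⊥)
open import Algebra.Bundles using (CommutativeRing)
open import Relation.Nullary using (¬_)
open import Relation.Binary.PropositionalEquality as ≡ using (_≡_)
open import Function.Bundles using (Inverse)

-- The value of _⁻¹ at 0 is irrelevant.
record FiniteField (c ℓ : Level) : Set (lsuc (c ⊔ ℓ)) where
  field
    commutativeRing : CommutativeRing c ℓ
  open CommutativeRing commutativeRing public
  field
    _⁻¹         : Carrier → Carrier
    1≉0         : ¬ (1# ≈ 0#)
    inverseʳ    : ∀ x → ¬ (x ≈ 0#) → (x * (x ⁻¹)) ≈ 1#
    size        : ℕ
    enumeration : Inverse (≡.setoid (Fin size)) setoid

module FieldNotions {c ℓ : Level} (F : FiniteField c ℓ) where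
  open FiniteField F

  _^ᶠ_ : Carrier → ℕ → Carrier
  x ^ᶠ zero  = 1#
  x ^ᶠ suc k = x * (x ^ᶠ k)

  IsGenerator : Carrier → Set (c ⊔ ℓ)
  IsGenerator α = ¬ (α ≈ 0#) × (∀ x → ¬ (x ≈ 0#) → ∃ λ k → x ≈ (α ^ᶠ k))

  HasOrder : Carrier → ℕ → Set ℓ
  HasOrder g n = (0 < n) × ((g ^ᶠ n) ≈ 1#) × (∀ k → 0 < k → k < n → ¬ ((g ^ᶠ k) ≈ 1#))

  -- membership in the subfield GF(q) = { x | x^q = x } (for |F| = q^m)
  InGF : ℕ → Carrier → Set ℓ
  InGF q x = (x ^ᶠ q) ≈ x

  -- polynomials: coefficient lists, constant term first
  Poly : Set c
  Poly = List Carrier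

  eval : Poly → Carrier → Carrier
  eval []       x = 0#
  eval (a ∷ as) x = a + (x * eval as x)

  Monic : Poly → Set ℓ
  Monic []           = Lift ℓ ⊥
    where open import Level using (Lift)
  Monic (a ∷ [])     = a ≈ 1#
  Monic (a ∷ b ∷ fs) = Monic (b ∷ fs)

  IsMinimalPolynomial : ℕ → Carrier → Poly → Set (c ⊔ ℓ)
  IsMinimalPolynomial q x f =
    Monic f × All (InGF q) f × (eval f x ≈ 0#) ×
    (∀ (k : Poly) → Monic k → All (InGF q) k → eval k x ≈ 0# → length f ≤ length k)

{-# OPTIONS --safe #-}
-- Let q = p^s, N = q^m − 1 = |F^*| and β = α^t.  Since α has order N = a n, g = α^a has order n.
-- As q^m = (1 + (q − 1))^m ≡ 1 + m (q − 1) modulo (q − 1)², n ≡ h m modulo q − 1, so e ∣ n, N ∣ t n and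
-- (g β)^n = 1.  In characteristic p the map z ↦ z^q is a ring endomorphism; its iterates fix every
-- element after m steps, and it fixes the coefficients of ∏_{i<m} (X − x^(q^i)) for x = g⁻¹.  By
-- minimality the minimal polynomial of x therefore has degree at most m, while it vanishes at the m
-- conjugates x^(q^i), which are distinct because q^i − 1 < n for 0 < i < m.  If y = (β g)⁻¹ had the same
-- minimal polynomial, that polynomial would also vanish at y, giving m + 1 roots unless y = x^(q^j) for
-- some j < m, i.e. β = g^(q^j − 1), i.e. t = a (q^j − 1).  Multiplying by h e turns this into
-- (q − 1)(q^j − 1) e = h (q^m − 1), whose only solution with e ∣ q − 1, h ∣ q − 1, e > 1 is the exceptional
-- case q = 3, h = 1, e = 2, m = 2.

module Submission where

open import Defs
open import Level using (Level; _⊔_)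
open import Data.Nat using (ℕ; _*_; _∸_; _^_; _<_)
open import Data.Nat.Divisibility using (_∣_)
open import Data.Nat.GCD using (gcd)
open import Data.Nat.Primality using (Prime)
open import Data.Product using (_×_; _,_)
open import Data.List.Relation.Binary.Pointwise using (Pointwise)
open import Relation.Nullary using (¬_)
open import Relation.Binary.PropositionalEquality using (_≡_)

module Arithmetic where
  open import Data.Nat
  open import Data.Nat.Properties
  open import Data.Nat.Divisibility
  open import Data.Nat.Primality
  open import Data.Nat.Combinatorics using (_C_; nCk≡n!/k![n-k]!; k![n∸k]!∣n!)
  open import Data.Nat.DivMod using (m*[n/m]≡n)
  open import Function.Base using (_∘_)
  open import Data.Nat.Tactic.RingSolver using (solve-∀; solve)
  open import Data.List.Base using (_∷_; [])
  open import Data.Sum using (inj₁; inj₂)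
  open import Data.Product using (_,_; _×_; ∃)
  open import Relation.Nullary using (contradiction; yes; no)
  open import Relation.Binary.PropositionalEquality
  open import Relation.Binary.Definitions using (tri<; tri≈; tri>)

  prime⇒2≤ : ∀ {p} → Prime p → 2 ≤ p
  prime⇒2≤ {p} p-prime = nonTrivial⇒n>1 p {{prime⇒nonTrivial p-prime}}

  prime∤! : ∀ {p} → Prime p → ∀ k → k < p → p ∤ k !
  prime∤! p-prime zero    k<p p∣1 = <⇒≢ (prime⇒2≤ p-prime) (sym (∣1⇒≡1 p∣1))
  prime∤! p-prime (suc k) k<p p∣k! with euclidsLemma (suc k) (k !) p-prime p∣k!
  ... | inj₁ p∣1+k = <⇒≱ k<p (∣⇒≤ p∣1+k)
  ... | inj₂ p∣k!  = prime∤! p-prime k (<-trans (n<1+n k) k<p) p∣k!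

  prime∣choose : ∀ {p} → Prime p → ∀ k → 0 < k → k < p → p ∣ p C k
  prime∣choose {p} p-prime k 0<k k<p
    with euclidsLemma (k ! * (p ∸ k) !) (p C k) p-prime p∣product
    where
    instance _ = k !* (p ∸ k) !≢0
    product≡p! : k ! * (p ∸ k) ! * (p C k) ≡ p !
    product≡p! = trans (cong (k ! * (p ∸ k) ! *_) (nCk≡n!/k![n-k]! (<⇒≤ k<p)))
                       (m*[n/m]≡n (k![n∸k]!∣n! (<⇒≤ k<p)))
    p∣product : p ∣ k ! * (p ∸ k) ! * (p C k)
    p∣product = subst (p ∣_) (sym product≡p!) (n∣n! (<-trans z<s (prime⇒2≤ p-prime)))
      where
      n∣n! : ∀ {n} → 0 < n → n ∣ n !
      n∣n! {suc n} _ = m∣m*n (n !)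
  ... | inj₂ p∣C = p∣C
  ... | inj₁ p∣k![p∸k]! with euclidsLemma (k !) ((p ∸ k) !) p-prime p∣k![p∸k]!
  ...   | inj₁ p∣k!     = contradiction p∣k! (prime∤! p-prime k k<p)
  ...   | inj₂ p∣[p∸k]! = contradiction p∣[p∸k]! (prime∤! p-prime (p ∸ k) (∸-monoʳ-< 0<k (<⇒≤ k<p)))

  0<m*n⇒0<m : ∀ m {n} → 0 < m * n → 0 < m
  0<m*n⇒0<m (suc m) _ = z<s

  0<m*n⇒0<n : ∀ m {n} → 0 < m * n → 0 < n
  0<m*n⇒0<n m {n} 0<mn = 0<m*n⇒0<m n (subst (0 <_) (*-comm m n) 0<mn)

  0<q^m∸1 : ∀ q m → 2 ≤ q → 0 < m → 0 < q ^ m ∸ 1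
  0<q^m∸1 q (suc m) 2≤q _ =
    ∸-monoˡ-≤ 1 (≤-trans 2≤q (m≤m*n q (q ^ m) {{m^n≢0 q m {{>-nonZero (<-trans z<s 2≤q)}}}}))

  ^-expansion : ∀ w m → ∃ λ T → suc w ^ m ≡ 1 + w * (m + w * T)
  ^-expansion w zero    = 0 , cong suc (sym (w*[0+w*0]≡0 w))
    where
    w*[0+w*0]≡0 : ∀ w → w * (0 + w * 0) ≡ 0
    w*[0+w*0]≡0 = solve-∀
  ^-expansion w (suc m) with T , q^m≡ ← ^-expansion w m =
    T + m + w * T , trans (cong (suc w *_) q^m≡) (expand w m T)
    where
    expand : ∀ w m T → (1 + w) * (1 + w * (m + w * T)) ≡ 1 + w * ((1 + m) + w * (T + m + w * T))
    expand = solve-∀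

  a*h≡q∸1⇒a*n≡q^m∸1 : ∀ {q m h n a} → 0 < h → n * (q ∸ 1) ≡ h * (q ^ m ∸ 1) →
                       a * h ≡ q ∸ 1 → a * n ≡ q ^ m ∸ 1
  a*h≡q∸1⇒a*n≡q^m∸1 {q} {m} {h} {n} {a} 0<h n*[q∸1]≡h*[q^m∸1] a*h≡q∸1 =
    *-cancelˡ-≡ (a * n) (q ^ m ∸ 1) h {{>-nonZero 0<h}} (begin
      h * (a * n)       ≡⟨ solve (h ∷ a ∷ n ∷ []) ⟩
      (a * h) * n       ≡⟨ cong (_* n) a*h≡q∸1 ⟩
      (q ∸ 1) * n       ≡⟨ *-comm (q ∸ 1) n ⟩
      n * (q ∸ 1)       ≡⟨ n*[q∸1]≡h*[q^m∸1] ⟩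
      h * (q ^ m ∸ 1)   ∎)
    where open ≡-Reasoning

  ∣[q∸1]∧∣hm⇒∣n : ∀ {q m h n e} → 2 ≤ q → n * (q ∸ 1) ≡ h * (q ^ m ∸ 1) →
                  e ∣ q ∸ 1 → e ∣ h * m → e ∣ n
  ∣[q∸1]∧∣hm⇒∣n {suc w} {m} {h} {n} {e} (s≤s 1≤w) n*w≡ e∣w e∣hm
    with T , q^m≡ ← ^-expansion w m =
    subst (e ∣_) (sym n≡) (∣m∣n⇒∣m+n e∣hm (∣-trans e∣w (divides (h * T) (solve (h ∷ w ∷ T ∷ [])))))
    where
    open ≡-Reasoning
    n≡ : n ≡ h * m + h * (w * T)
    n≡ = *-cancelʳ-≡ n _ w {{>-nonZero 1≤w}} (begin
      n * w                         ≡⟨ n*w≡ ⟩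
      h * (suc w ^ m ∸ 1)           ≡⟨ cong (λ x → h * (x ∸ 1)) q^m≡ ⟩
      h * (w * (m + w * T))         ≡⟨ solve (h ∷ w ∷ m ∷ T ∷ []) ⟩
      (h * m + h * (w * T)) * w     ∎)

  [q∸1]*[q^j∸1]<q^m∸1 : ∀ {q m j} → 2 ≤ q → j < m → (q ∸ 1) * (q ^ j ∸ 1) < q ^ m ∸ 1
  [q∸1]*[q^j∸1]<q^m∸1 {suc w} {m} {j} (s≤s 1≤w) j<m =
    ≤-trans (w*[X∸1]<q*X∸1 (q ^ j) (m^n>0 q j)) (∸-monoˡ-≤ 1 (^-monoʳ-≤ q j<m))
    where
    q = suc w
    w*[X∸1]<q*X∸1 : ∀ X → 0 < X → w * (X ∸ 1) < q * X ∸ 1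
    w*[X∸1]<q*X∸1 (suc X) _ = begin-strict
      w * X            <⟨ *-monoʳ-< w {{>-nonZero 1≤w}} (n<1+n X) ⟩
      w * suc X        ≤⟨ m≤n+m _ X ⟩
      X + w * suc X    ∎
      where open ≤-Reasoning

  q^j∸1<n : ∀ {q m h n j} → 2 ≤ q → 0 < h → n * (q ∸ 1) ≡ h * (q ^ m ∸ 1) → j < m → q ^ j ∸ 1 < n
  q^j∸1<n {q} {m} {h} {n} {j} 2≤q 0<h n*[q∸1]≡ j<m = *-cancelʳ-< (q ∸ 1) (q ^ j ∸ 1) n (begin-strict
    (q ^ j ∸ 1) * (q ∸ 1)   ≡⟨ *-comm (q ^ j ∸ 1) (q ∸ 1) ⟩
    (q ∸ 1) * (q ^ j ∸ 1)   <⟨ [q∸1]*[q^j∸1]<q^m∸1 2≤q j<m ⟩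
    q ^ m ∸ 1               ≤⟨ m≤n*m (q ^ m ∸ 1) h {{>-nonZero 0<h}} ⟩
    h * (q ^ m ∸ 1)         ≡⟨ n*[q∸1]≡ ⟨
    n * (q ∸ 1)             ∎)
    where open ≤-Reasoning

  w*e≡h*[2+w]⇒ : ∀ {w e h} → 0 < w → 0 < h → e ∣ w → w * e ≡ h * (2 + w) → w ≡ 2 × e ≡ 2 × h ≡ 1
  w*e≡h*[2+w]⇒ {w} {e} {h} 0<w 0<h e∣w w*e≡ with <-cmp e (suc h)
  ... | tri< e≤h _ _ = contradiction w*e≡ (<⇒≢ (begin-strict
    w * e           ≤⟨ *-monoʳ-≤ w (s≤s⁻¹ e≤h) ⟩
    w * h           <⟨ m<n+m (w * h) (*-monoʳ-< 2 0<h) ⟩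
    2 * h + w * h   ≡⟨ solve (w ∷ h ∷ []) ⟩
    h * (2 + w)     ∎))
    where open ≤-Reasoning
  ... | tri> _ _ 2+h≤e = contradiction w*e≡ (<⇒≢ (begin-strict
    h * (2 + w)     ≡⟨ solve (w ∷ h ∷ []) ⟩
    2 * h + w * h   <⟨ +-monoˡ-< (w * h) (*-monoʳ-< 2 h<w) ⟩
    2 * w + w * h   ≡⟨ solve (w ∷ h ∷ []) ⟩
    w * (2 + h)     ≤⟨ *-monoʳ-≤ w 2+h≤e ⟩
    w * e           ∎) ∘ sym)
    where
    open ≤-Reasoning
    h<w : h < w
    h<w = <-≤-trans (<-trans (n<1+n h) 2+h≤e) (∣⇒≤ {{>-nonZero 0<w}} e∣w)
  ... | tri≈ _ refl _ = w≡2 , cong suc h≡1 , h≡1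
    where
    w≡2*h : w ≡ 2 * h
    w≡2*h = +-cancelʳ-≡ (w * h) w (2 * h) (begin
      w + w * h       ≡⟨ solve (w ∷ h ∷ []) ⟩
      w * suc h       ≡⟨ w*e≡ ⟩
      h * (2 + w)     ≡⟨ solve (w ∷ h ∷ []) ⟩
      2 * h + w * h   ∎)
      where open ≡-Reasoning
    h≡1 : h ≡ 1
    h≡1 = ≤-antisym (s≤s⁻¹ (∣⇒≤ 1+h∣2)) 0<h
      where
      1+h∣2 : suc h ∣ 2
      1+h∣2 = ∣m+n∣m⇒∣n (divides 2 (trans (+-comm (2 * h) 2) (sym (*-suc 2 h)))) (subst (suc h ∣_) w≡2*h e∣w)
    w≡2 : w ≡ 2
    w≡2 = trans w≡2*h (cong (2 *_) h≡1)

  u*[X∸1]≡h*[Z∸1]⇒ : ∀ {u h X Z} → 0 < X → 0 < Z → u * (X ∸ 1) ≡ h * (Z ∸ 1) → u * X + h ≡ h * Z + u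
  u*[X∸1]≡h*[Z∸1]⇒ {u} {h} {suc X} {suc Z} _ _ eq = begin
    u * suc X + h     ≡⟨ solve (u ∷ h ∷ X ∷ []) ⟩
    u * X + (u + h)   ≡⟨ cong (_+ (u + h)) eq ⟩
    h * Z + (u + h)   ≡⟨ solve (u ∷ h ∷ Z ∷ []) ⟩
    h * suc Z + u     ∎
    where open ≡-Reasoning

  cofactor : ∀ {u h X Y} → 0 < X → h < u → u * X + h ≡ h * (X * Y) + u →
             ∃ λ K → u ≡ h * Y + K × X * K + h ≡ u
  cofactor {u} {h} {X} {Y} 0<X h<u eq with h * Y ≤? u
  ... | no  hY≰u = contradiction eq (<⇒≢ (begin-strict
    u * X + h           <⟨ +-monoʳ-< (u * X) h<u ⟩
    u * X + u           <⟨ +-monoˡ-< u (*-monoˡ-< X {{>-nonZero 0<X}} (≰⇒> hY≰u)) ⟩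
    h * Y * X + u       ≡⟨ cong (_+ u) (solve (X ∷ h ∷ Y ∷ [])) ⟩
    h * (X * Y) + u     ∎))
    where open ≤-Reasoning
  ... | yes hY≤u with K , u≡hY+K ← m≤n⇒∃[o]m+o≡n hY≤u = K , sym u≡hY+K , XK+h≡u
    where
    XK+h≡u : X * K + h ≡ u
    XK+h≡u = +-cancelˡ-≡ (h * (X * Y)) (X * K + h) u (begin
      h * (X * Y) + (X * K + h)   ≡⟨ solve (h ∷ X ∷ Y ∷ K ∷ []) ⟩
      (h * Y + K) * X + h         ≡⟨ cong (λ v → v * X + h) u≡hY+K ⟩
      u * X + h                   ≡⟨ eq ⟩
      h * (X * Y) + u             ∎)
      where open ≡-Reasoning

  q^i<q*q⇒i≤1 : ∀ {q i} → 0 < q → q ^ i < q * q → i ≤ 1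
  q^i<q*q⇒i≤1 {i = zero}        _   _     = z≤n
  q^i<q*q⇒i≤1 {i = suc zero}    _   _     = ≤-refl
  q^i<q*q⇒i≤1 {q} {suc (suc i)} 0<q q^i<qq = contradiction q^i<qq
    (≤⇒≯ (*-monoʳ-≤ q (m≤m*n q (q ^ i) {{m^n≢0 q i {{>-nonZero 0<q}}}})))

  cofactor-bounds : ∀ {w e h X Y} → 0 < w → 2 ≤ e → e ∣ w → 0 < h → h ∣ w → 0 < X →
                    w * e * X + h ≡ h * (X * Y) + w * e → X < suc w * suc w × Y < suc w * suc w
  cofactor-bounds {w} {e} {h} {X} {Y} 0<w 2≤e e∣w 0<h h∣w 0<X eq
    with h<we ← ≤-<-trans (∣⇒≤ {{>-nonZero 0<w}} h∣w) (m<m*n w e {{>-nonZero 0<w}} 2≤e)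
    with cofactor 0<X h<we eq
  ... | zero  , _       , X0+h≡we = contradiction (trans (sym (cong (_+ h) (*-zeroʳ X))) X0+h≡we) (<⇒≢ h<we)
  ... | suc K , we≡hY+K , XK+h≡we =
    (begin-strict
       X                 ≤⟨ m≤m*n X (suc K) ⟩
       X * suc K         <⟨ m<m+n (X * suc K) 0<h ⟩
       X * suc K + h     ≡⟨ XK+h≡we ⟩
       w * e             <⟨ we<qq ⟩
       suc w * suc w     ∎) ,
    (begin-strict
       Y                 ≤⟨ m≤n*m Y h {{>-nonZero 0<h}} ⟩
       h * Y             <⟨ m<m+n (h * Y) z<s ⟩
       h * Y + suc K     ≡⟨ we≡hY+K ⟨
       w * e             <⟨ we<qq ⟩
       suc w * suc w     ∎)
    where
    open ≤-Reasoning
    instance _ = >-nonZero 0<w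
    we<qq : w * e < suc w * suc w
    we<qq = ≤-<-trans (*-monoʳ-≤ w (∣⇒≤ e∣w)) (*-mono-< (n<1+n w) (n<1+n w))

  w*e*q+h≡h*q*q+w*e⇒ : ∀ {w e h} → 0 < w → w * e * suc w + h ≡ h * (suc w * suc w) + w * e →
                       w * e ≡ h * (2 + w)
  w*e*q+h≡h*q*q+w*e⇒ {w} {e} {h} 0<w eq = *-cancelˡ-≡ (w * e) (h * (2 + w)) w {{>-nonZero 0<w}}
    (+-cancelʳ-≡ (w * e + h) (w * (w * e)) (w * (h * (2 + w))) (begin
      w * (w * e) + (w * e + h)         ≡⟨ solve (w ∷ e ∷ h ∷ []) ⟩
      w * e * suc w + h                 ≡⟨ eq ⟩
      h * (suc w * suc w) + w * e       ≡⟨ solve (w ∷ e ∷ h ∷ []) ⟩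
      w * (h * (2 + w)) + (w * e + h)   ∎))
    where open ≡-Reasoning

  additive-form : ∀ w e h i k → w * (suc w ^ i ∸ 1) * e ≡ h * (suc w ^ (i + k) ∸ 1) →
                  w * e * suc w ^ i + h ≡ h * (suc w ^ i * suc w ^ k) + w * e
  additive-form w e h i k eq = u*[X∸1]≡h*[Z∸1]⇒ {w * e} {h} (m^n>0 q i) (subst (0 <_) q^[i+k]≡ (m^n>0 q (i + k))) (begin
    w * e * (q ^ i ∸ 1)       ≡⟨ *-assoc-comm w e (q ^ i ∸ 1) ⟩
    w * (q ^ i ∸ 1) * e       ≡⟨ eq ⟩
    h * (q ^ (i + k) ∸ 1)     ≡⟨ cong (λ Z → h * (Z ∸ 1)) q^[i+k]≡ ⟩
    h * (q ^ i * q ^ k ∸ 1)   ∎)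
    where
    open ≡-Reasoning
    q = suc w
    q^[i+k]≡ : q ^ (i + k) ≡ q ^ i * q ^ k
    q^[i+k]≡ = ^-distribˡ-+-* q i k
    *-assoc-comm : ∀ a b c → a * b * c ≡ a * c * b
    *-assoc-comm = solve-∀

  -- With X = q^j and Y = q^(m − j) the equation reads (q − 1) e (X − 1) = h (X Y − 1); it forces X to divide
  -- (q − 1) e − h < q², and h Y < (q − 1) e < q², so j = m − j = 1, after which it is linear in e and h.
  exceptional-parameters : ∀ {q m j e h} → 2 ≤ q → 2 ≤ e → e ∣ q ∸ 1 → 0 < h → h ∣ q ∸ 1 → j < m →
                           (q ∸ 1) * (q ^ j ∸ 1) * e ≡ h * (q ^ m ∸ 1) →
                           q ≡ 3 × h ≡ 1 × e ≡ 2 × m ≡ 2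
  exceptional-parameters {suc w} {m} {zero} {e} (s≤s 1≤w) _ _ 0<h _ 0<m eq =
    contradiction (trans (sym eq) (cong (_* e) (*-zeroʳ w)))
                  (≢-nonZero⁻¹ _ {{m*n≢0 _ _ {{>-nonZero 0<h}} {{>-nonZero (0<q^m∸1 (suc w) m (s≤s 1≤w) 0<m)}}}})
  exceptional-parameters {suc w} {m} {suc j} {e} {h} (s≤s 1≤w) 2≤e e∣w 0<h h∣w j<m eq
    with k , 2+j+k≡m ← m≤n⇒∃[o]m+o≡n j<m
    with additive ← additive-form w e h (suc j) (suc k)
                      (subst (λ i → w * (suc w ^ suc j ∸ 1) * e ≡ h * (suc w ^ i ∸ 1))
                             (trans (sym 2+j+k≡m) (sym (+-suc (suc j) k))) eq)
    with X<qq , Y<qq ← cofactor-bounds 1≤w 2≤e e∣w 0<h h∣w (m^n>0 (suc w) (suc j)) additive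
    with s≤s z≤n ← q^i<q*q⇒i≤1 {i = suc j} z<s X<qq
    with s≤s z≤n ← q^i<q*q⇒i≤1 {i = suc k} z<s Y<qq
    with w≡2 , e≡2 , h≡1 ← w*e≡h*[2+w]⇒ 1≤w 0<h e∣w (w*e*q+h≡h*q*q+w*e⇒ 1≤w
           (subst (λ x → w * e * x + h ≡ h * (x * x) + w * e) (*-identityʳ (suc w)) additive))
    = cong suc w≡2 , h≡1 , e≡2 , sym 2+j+k≡m

  t≡a*[q^j∸1]⇒exceptional : ∀ {q m j e h a t} → 2 ≤ q → 2 ≤ e → e ∣ q ∸ 1 → 0 < h → h ∣ q ∸ 1 → j < m →
                             a * h ≡ q ∸ 1 → t * e ≡ q ^ m ∸ 1 → t ≡ a * (q ^ j ∸ 1) →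
                             q ≡ 3 × h ≡ 1 × e ≡ 2 × m ≡ 2
  t≡a*[q^j∸1]⇒exceptional {q} {m} {j} {e} {h} {a} {t} 2≤q 2≤e e∣q∸1 0<h h∣q∸1 j<m a*h≡q∸1 t*e≡q^m∸1 t≡aX =
    exceptional-parameters 2≤q 2≤e e∣q∸1 0<h h∣q∸1 j<m (begin
      (q ∸ 1) * X * e     ≡⟨ cong (λ w → w * X * e) a*h≡q∸1 ⟨
      a * h * X * e       ≡⟨ rearrange a h X e ⟩
      h * (a * X * e)     ≡⟨ cong (λ u → h * (u * e)) t≡aX ⟨
      h * (t * e)         ≡⟨ cong (h *_) t*e≡q^m∸1 ⟩
      h * (q ^ m ∸ 1)     ∎)
    where
    X = q ^ j ∸ 1
    open ≡-Reasoning
    rearrange : ∀ a h X e → a * h * X * e ≡ h * (a * X * e)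
    rearrange = solve-∀

module FieldProperties {c ℓ : Level} (F : FiniteField c ℓ) where

  open import Data.Nat as ℕ using (zero; suc; z<s)
  import Data.Nat.Properties as ℕₚ
  open import Data.Nat.DivMod using (_%_; _/_; m≡m%n+[m/n]*n; m%n<n)
  open import Data.Nat.Divisibility using (divides)
  open import Data.Fin as Fin using (Fin; toℕ; fromℕ<; punchIn; punchOut)
  import Data.Fin.Properties as Finₚ
  open import Data.Product using (_,_; proj₁; proj₂; ∃)
  open import Function.Base using (_∘_)
  open import Function.Bundles using (Inverse)
  open import Relation.Nullary using (Dec; yes; no; contradiction)
  open import Relation.Binary.Definitions using (tri<; tri≈; tri>)
  import Relation.Binary.PropositionalEquality as ≡
  open import Algebra.Morphism.Structures using (module SemiringMorphisms)
  open SemiringMorphisms using (IsSemiringHomomorphism)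

  open FiniteField F renaming (_*_ to _·_)
  open FieldNotions F
  open import Algebra.Bundles using (Semiring)
  open Semiring semiring using (rawSemiring)
  open import Algebra.Properties.CommutativeSemiring.Exp commutativeSemiring
    using (^-congˡ; ^-homo-*; ^-assocʳ; ^-distrib-*) renaming (_^_ to _^ʳ_)
  open import Relation.Binary.Reasoning.Setoid setoid

  module Enumeration {n : ℕ} (size≡n : size ≡ n) where

    enumeration′ : Inverse (≡.setoid (Fin n)) setoid
    enumeration′ = ≡.subst (λ k → Inverse (≡.setoid (Fin k)) setoid) size≡n enumeration

    open Inverse enumeration′ public using (to; from; from-cong; strictlyInverseˡ; strictlyInverseʳ)

    from-injective : ∀ {x y} → from x ≡ from y → x ≈ y
    from-injective = inverseʳ⇒injective from (Inverse.inverseˡ enumeration′)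
      where open import Function.Consequences.Setoid setoid (≡.setoid (Fin n)) using (inverseʳ⇒injective)

  private module E = Enumeration ≡.refl

  IsSemiringEndomorphism : (Carrier → Carrier) → Set (c ⊔ ℓ)
  IsSemiringEndomorphism = IsSemiringHomomorphism rawSemiring rawSemiring

  infix 4 _≟_
  _≟_ : ∀ x y → Dec (x ≈ y)
  x ≟ y with E.from x Fin.≟ E.from y
  ... | yes i≡j = yes (E.from-injective i≡j)
  ... | no  i≢j = no (i≢j ∘ E.from-cong)

  x⁻¹≉0 : ∀ {x} → x ≉ 0# → x ⁻¹ ≉ 0#
  x⁻¹≉0 {x} x≉0 x⁻¹≈0 = 1≉0 (begin
    1#          ≈⟨ inverseʳ x x≉0 ⟨
    x · x ⁻¹    ≈⟨ *-congˡ x⁻¹≈0 ⟩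
    x · 0#      ≈⟨ zeroʳ x ⟩
    0#          ∎)

  inverseˡ : ∀ x → x ≉ 0# → x ⁻¹ · x ≈ 1#
  inverseˡ x x≉0 = trans (*-comm (x ⁻¹) x) (inverseʳ x x≉0)

  ·-cancelˡ : ∀ {z x y} → z ≉ 0# → z · x ≈ z · y → x ≈ y
  ·-cancelˡ {z} {x} {y} z≉0 zx≈zy = begin
    x                 ≈⟨ *-identityˡ x ⟨
    1# · x            ≈⟨ *-congʳ (inverseˡ z z≉0) ⟨
    (z ⁻¹ · z) · x    ≈⟨ *-assoc _ _ _ ⟩
    z ⁻¹ · (z · x)    ≈⟨ *-congˡ zx≈zy ⟩
    z ⁻¹ · (z · y)    ≈⟨ *-assoc _ _ _ ⟨
    (z ⁻¹ · z) · y    ≈⟨ *-congʳ (inverseˡ z z≉0) ⟩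
    1# · y            ≈⟨ *-identityˡ y ⟩
    y                 ∎

  x≉0∧y≉0⇒x·y≉0 : ∀ {x y} → x ≉ 0# → y ≉ 0# → x · y ≉ 0#
  x≉0∧y≉0⇒x·y≉0 {x} x≉0 y≉0 xy≈0 = y≉0 (·-cancelˡ x≉0 (trans xy≈0 (sym (zeroʳ x))))

  ⁻¹-unique : ∀ {x y} → x ≉ 0# → x · y ≈ 1# → y ≈ x ⁻¹
  ⁻¹-unique {x} x≉0 xy≈1 = ·-cancelˡ x≉0 (trans xy≈1 (sym (inverseʳ x x≉0)))

  ⁻¹-injective : ∀ {x y} → x ≉ 0# → y ≉ 0# → x ⁻¹ ≈ y ⁻¹ → x ≈ y
  ⁻¹-injective {x} {y} x≉0 y≉0 x⁻¹≈y⁻¹ =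
    ·-cancelˡ (x⁻¹≉0 x≉0) (trans (inverseˡ x x≉0) (trans (sym (inverseˡ y y≉0)) (*-congʳ (sym x⁻¹≈y⁻¹))))

  ^ᶠ≈^ʳ : ∀ x n → x ^ᶠ n ≈ x ^ʳ n
  ^ᶠ≈^ʳ x zero    = refl
  ^ᶠ≈^ʳ x (suc n) = *-congˡ (^ᶠ≈^ʳ x n)

  ^ᶠ-congˡ : ∀ {x y} n → x ≈ y → x ^ᶠ n ≈ y ^ᶠ n
  ^ᶠ-congˡ zero    x≈y = refl
  ^ᶠ-congˡ (suc n) x≈y = *-cong x≈y (^ᶠ-congˡ n x≈y)

  ^ᶠ-congʳ : ∀ x {m n} → m ≡ n → x ^ᶠ m ≈ x ^ᶠ n
  ^ᶠ-congʳ x m≡n = reflexive (≡.cong (x ^ᶠ_) m≡n)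

  ^ᶠ-homo-· : ∀ x m n → x ^ᶠ (m ℕ.+ n) ≈ x ^ᶠ m · x ^ᶠ n
  ^ᶠ-homo-· x m n = begin
    x ^ᶠ (m ℕ.+ n)      ≈⟨ ^ᶠ≈^ʳ x (m ℕ.+ n) ⟩
    x ^ʳ (m ℕ.+ n)      ≈⟨ ^-homo-* x m n ⟩
    x ^ʳ m · x ^ʳ n     ≈⟨ *-cong (^ᶠ≈^ʳ x m) (^ᶠ≈^ʳ x n) ⟨
    x ^ᶠ m · x ^ᶠ n     ∎

  ^ᶠ-assoc : ∀ x m n → (x ^ᶠ m) ^ᶠ n ≈ x ^ᶠ (m * n)
  ^ᶠ-assoc x m n = begin
    (x ^ᶠ m) ^ᶠ n       ≈⟨ ^ᶠ≈^ʳ (x ^ᶠ m) n ⟩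
    (x ^ᶠ m) ^ʳ n       ≈⟨ ^-congˡ n (^ᶠ≈^ʳ x m) ⟩
    (x ^ʳ m) ^ʳ n       ≈⟨ ^-assocʳ x m n ⟩
    x ^ʳ (m * n)        ≈⟨ ^ᶠ≈^ʳ x (m * n) ⟨
    x ^ᶠ (m * n)        ∎

  ^ᶠ-distrib-· : ∀ x y n → (x · y) ^ᶠ n ≈ x ^ᶠ n · y ^ᶠ n
  ^ᶠ-distrib-· x y n = begin
    (x · y) ^ᶠ n        ≈⟨ ^ᶠ≈^ʳ (x · y) n ⟩
    (x · y) ^ʳ n        ≈⟨ ^-distrib-* x y n ⟩
    x ^ʳ n · y ^ʳ n     ≈⟨ *-cong (^ᶠ≈^ʳ x n) (^ᶠ≈^ʳ y n) ⟨
    x ^ᶠ n · y ^ᶠ n     ∎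

  1^ᶠ : ∀ n → 1# ^ᶠ n ≈ 1#
  1^ᶠ zero    = refl
  1^ᶠ (suc n) = trans (*-identityˡ _) (1^ᶠ n)

  0^ᶠ : ∀ {n} → 0 < n → 0# ^ᶠ n ≈ 0#
  0^ᶠ {suc n} _ = zeroˡ _

  ^ᶠ-≉0 : ∀ {x} n → x ≉ 0# → x ^ᶠ n ≉ 0#
  ^ᶠ-≉0 zero    x≉0 = 1≉0
  ^ᶠ-≉0 (suc n) x≉0 = x≉0∧y≉0⇒x·y≉0 x≉0 (^ᶠ-≉0 n x≉0)

  ^ᶠ≈1⇒≉0 : ∀ {x n} → 0 < n → x ^ᶠ n ≈ 1# → x ≉ 0#
  ^ᶠ≈1⇒≉0 {x} {n} 0<n xⁿ≈1 x≈0 = 1≉0 (trans (sym xⁿ≈1) (trans (^ᶠ-congˡ n x≈0) (0^ᶠ 0<n)))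

  ⁻¹-^ᶠ : ∀ {x} n → x ≉ 0# → (x ⁻¹) ^ᶠ n ≈ (x ^ᶠ n) ⁻¹
  ⁻¹-^ᶠ {x} n x≉0 = ⁻¹-unique (^ᶠ-≉0 n x≉0) (begin
    x ^ᶠ n · (x ⁻¹) ^ᶠ n    ≈⟨ ^ᶠ-distrib-· x (x ⁻¹) n ⟨
    (x · x ⁻¹) ^ᶠ n         ≈⟨ ^ᶠ-congˡ n (inverseʳ x x≉0) ⟩
    1# ^ᶠ n                 ≈⟨ 1^ᶠ n ⟩
    1#                      ∎)

  ⁻¹-^ᶠ≈1⇒^ᶠ≈1 : ∀ {x} n → x ≉ 0# → (x ⁻¹) ^ᶠ n ≈ 1# → x ^ᶠ n ≈ 1#
  ⁻¹-^ᶠ≈1⇒^ᶠ≈1 {x} n x≉0 x⁻ⁿ≈1 = begin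
    x ^ᶠ n                  ≈⟨ *-identityʳ _ ⟨
    x ^ᶠ n · 1#             ≈⟨ *-congˡ x⁻ⁿ≈1 ⟨
    x ^ᶠ n · (x ⁻¹) ^ᶠ n    ≈⟨ *-congˡ (⁻¹-^ᶠ n x≉0) ⟩
    x ^ᶠ n · (x ^ᶠ n) ⁻¹    ≈⟨ inverseʳ _ (^ᶠ-≉0 n x≉0) ⟩
    1#                      ∎

  ^ᶠ≈1∧∣⇒^ᶠ≈1 : ∀ {x n k} → x ^ᶠ n ≈ 1# → n ∣ k → x ^ᶠ k ≈ 1#
  ^ᶠ≈1∧∣⇒^ᶠ≈1 {x} {n} xⁿ≈1 (divides d ≡.refl) = begin
    x ^ᶠ (d * n)     ≈⟨ ^ᶠ-congʳ x (ℕₚ.*-comm d n) ⟩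
    x ^ᶠ (n * d)     ≈⟨ ^ᶠ-assoc x n d ⟨
    (x ^ᶠ n) ^ᶠ d    ≈⟨ ^ᶠ-congˡ d xⁿ≈1 ⟩
    1# ^ᶠ d          ≈⟨ 1^ᶠ d ⟩
    1#               ∎

  ^ᶠ≈1⇒^ᶠ-%≈ : ∀ {x n} .{{_ : ℕ.NonZero n}} k → x ^ᶠ n ≈ 1# → x ^ᶠ k ≈ x ^ᶠ (k % n)
  ^ᶠ≈1⇒^ᶠ-%≈ {x} {n} k xⁿ≈1 = begin
    x ^ᶠ k                               ≈⟨ ^ᶠ-congʳ x (m≡m%n+[m/n]*n k n) ⟩
    x ^ᶠ (k % n ℕ.+ (k / n) * n)         ≈⟨ ^ᶠ-homo-· x (k % n) ((k / n) * n) ⟩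
    x ^ᶠ (k % n) · x ^ᶠ ((k / n) * n)    ≈⟨ *-congˡ (^ᶠ≈1∧∣⇒^ᶠ≈1 xⁿ≈1 (divides (k / n) ≡.refl)) ⟩
    x ^ᶠ (k % n) · 1#                    ≈⟨ *-identityʳ _ ⟩
    x ^ᶠ (k % n)                         ∎

  ^ᶠ≈^ᶠ⇒^ᶠ∸≈1 : ∀ {x u v} → x ≉ 0# → u ℕ.≤ v → x ^ᶠ u ≈ x ^ᶠ v → x ^ᶠ (v ∸ u) ≈ 1#
  ^ᶠ≈^ᶠ⇒^ᶠ∸≈1 {x} {u} {v} x≉0 u≤v xᵘ≈xᵛ = ·-cancelˡ (^ᶠ-≉0 u x≉0) (begin
    x ^ᶠ u · x ^ᶠ (v ∸ u)    ≈⟨ ^ᶠ-homo-· x u (v ∸ u) ⟨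
    x ^ᶠ (u ℕ.+ (v ∸ u))     ≈⟨ ^ᶠ-congʳ x (ℕₚ.m+[n∸m]≡n u≤v) ⟩
    x ^ᶠ v                   ≈⟨ xᵘ≈xᵛ ⟨
    x ^ᶠ u                   ≈⟨ *-identityʳ _ ⟨
    x ^ᶠ u · 1#              ∎)

  hasOrder⇒≉0 : ∀ {g n} → HasOrder g n → g ≉ 0#
  hasOrder⇒≉0 (0<n , gⁿ≈1 , _) = ^ᶠ≈1⇒≉0 0<n gⁿ≈1

  hasOrder-distinct : ∀ {g n u v} → HasOrder g n → u < v → v < n → g ^ᶠ u ≉ g ^ᶠ v
  hasOrder-distinct {g} {n} {u} {v} g-order@(_ , _ , minimal) u<v v<n gᵘ≈gᵛ =
    minimal (v ∸ u) (ℕₚ.m<n⇒0<n∸m u<v) (ℕₚ.≤-<-trans (ℕₚ.m∸n≤m v u) v<n)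
            (^ᶠ≈^ᶠ⇒^ᶠ∸≈1 (hasOrder⇒≉0 g-order) (ℕₚ.<⇒≤ u<v) gᵘ≈gᵛ)

  hasOrder-injective : ∀ {g n u v} → HasOrder g n → u < n → v < n → g ^ᶠ u ≈ g ^ᶠ v → u ≡ v
  hasOrder-injective {u = u} {v} g-order u<n v<n gᵘ≈gᵛ with ℕₚ.<-cmp u v
  ... | tri< u<v _ _ = contradiction gᵘ≈gᵛ (hasOrder-distinct g-order u<v v<n)
  ... | tri≈ _ u≡v _ = u≡v
  ... | tri> _ _ v<u = contradiction (sym gᵘ≈gᵛ) (hasOrder-distinct g-order v<u u<n)

  hasOrder-^ᶠ : ∀ {g n} a → 0 < a → HasOrder g (a * n) → HasOrder (g ^ᶠ a) n
  hasOrder-^ᶠ {g} {n} a 0<a (0<an , gᵃⁿ≈1 , minimal) =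
    Arithmetic.0<m*n⇒0<n a 0<an ,
    trans (^ᶠ-assoc g a n) gᵃⁿ≈1 ,
    λ k 0<k k<n gᵃᵏ≈1 → minimal (a * k) (ℕₚ.*-mono-≤ 0<a 0<k) (ℕₚ.*-monoʳ-< a {{ℕ.>-nonZero 0<a}} k<n)
                                (trans (sym (^ᶠ-assoc g a k)) gᵃᵏ≈1)

  module Generator {N : ℕ} (size≡1+N : size ≡ suc N) {α : Carrier} (α-generator : IsGenerator α) where

    open Enumeration size≡1+N

    α≉0 : α ≉ 0#
    α≉0 = proj₁ α-generator

    nonzeroIndex : ∀ {x} → x ≉ 0# → Fin N
    nonzeroIndex x≉0 = punchOut (x≉0 ∘ sym ∘ from-injective)

    nonzeroIndex-injective : ∀ {x y} (x≉0 : x ≉ 0#) (y≉0 : y ≉ 0#) →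
                             nonzeroIndex x≉0 ≡ nonzeroIndex y≉0 → x ≈ y
    nonzeroIndex-injective x≉0 y≉0 =
      from-injective ∘ Finₚ.punchOut-injective (x≉0 ∘ sym ∘ from-injective) (y≉0 ∘ sym ∘ from-injective)

    nonzero : Fin N → Carrier
    nonzero i = to (punchIn (from 0#) i)

    nonzero≉0 : ∀ i → nonzero i ≉ 0#
    nonzero≉0 i i≈0 = Finₚ.punchInᵢ≢i (from 0#) i (≡.trans (≡.sym (strictlyInverseʳ _)) (from-cong i≈0))

    nonzero-injective : ∀ {i j} → nonzero i ≈ nonzero j → i ≡ j
    nonzero-injective {i} {j} i≈j = Finₚ.punchIn-injective (from 0#) i j
      (≡.trans (≡.sym (strictlyInverseʳ _)) (≡.trans (from-cong i≈j) (strictlyInverseʳ _)))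

    discreteLog : Fin N → ℕ
    discreteLog i = proj₁ (proj₂ α-generator (nonzero i) (nonzero≉0 i))

    nonzero≈α^discreteLog : ∀ i → nonzero i ≈ α ^ᶠ discreteLog i
    nonzero≈α^discreteLog i = proj₂ (proj₂ α-generator (nonzero i) (nonzero≉0 i))

    -- Every nonzero element is α^(l mod k), so the N nonzero elements inject into Fin k.
    period-≥ : ∀ {k} → 0 < k → α ^ᶠ k ≈ 1# → N ℕ.≤ k
    period-≥ {k} 0<k αᵏ≈1 = Finₚ.injective⇒≤ {f = residue} residue-injective
      where
      instance _ = ℕ.>-nonZero 0<k
      residue : Fin N → Fin k
      residue i = fromℕ< (m%n<n (discreteLog i) k)
      residue-injective : ∀ {i j} → residue i ≡ residue j → i ≡ j
      residue-injective {i} {j} eq = nonzero-injective (begin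
        nonzero i                        ≈⟨ nonzero≈α^discreteLog i ⟩
        α ^ᶠ discreteLog i               ≈⟨ ^ᶠ≈1⇒^ᶠ-%≈ (discreteLog i) αᵏ≈1 ⟩
        α ^ᶠ (discreteLog i % k)         ≈⟨ ^ᶠ-congʳ α (Finₚ.fromℕ<-injective _ _ _ _ eq) ⟩
        α ^ᶠ (discreteLog j % k)         ≈⟨ ^ᶠ≈1⇒^ᶠ-%≈ (discreteLog j) αᵏ≈1 ⟨
        α ^ᶠ discreteLog j               ≈⟨ nonzero≈α^discreteLog j ⟨
        nonzero j                        ∎)

    -- Pigeonhole: α⁰, …, α^N are N + 1 elements of the N-element set F^*.
    period-≤ : ∃ λ k → 0 < k × k ℕ.≤ N × α ^ᶠ k ≈ 1#
    period-≤ with i , j , i<j , eq ← Finₚ.pigeonhole (ℕₚ.n<1+n N) (λ i → nonzeroIndex (^ᶠ-≉0 (toℕ i) α≉0)) =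
      toℕ j ∸ toℕ i , ℕₚ.m<n⇒0<n∸m i<j ,
      ℕₚ.≤-trans (ℕₚ.m∸n≤m (toℕ j) (toℕ i)) (ℕ.s≤s⁻¹ (Finₚ.toℕ<n j)) ,
      ^ᶠ≈^ᶠ⇒^ᶠ∸≈1 α≉0 (ℕₚ.<⇒≤ i<j) (nonzeroIndex-injective (^ᶠ-≉0 (toℕ i) α≉0) (^ᶠ-≉0 (toℕ j) α≉0) eq)

    generator-hasOrder : HasOrder α N
    generator-hasOrder with k , 0<k , k≤N , αᵏ≈1 ← period-≤ =
      ℕₚ.<-≤-trans 0<k k≤N ,
      trans (^ᶠ-congʳ α (ℕₚ.≤-antisym (period-≥ 0<k αᵏ≈1) k≤N)) αᵏ≈1 ,
      λ k′ 0<k′ k′<N αᵏ′≈1 → ℕₚ.<⇒≱ k′<N (period-≥ 0<k′ αᵏ′≈1)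

    ^ᶠ-size≈id : ∀ z → z ^ᶠ suc N ≈ z
    ^ᶠ-size≈id z with z ≟ 0#
    ... | yes z≈0 = trans (^ᶠ-congˡ (suc N) z≈0) (trans (0^ᶠ {suc N} z<s) (sym z≈0))
    ... | no z≉0 with k , z≈αᵏ ← proj₂ α-generator z z≉0 = begin
      z · z ^ᶠ N           ≈⟨ *-congˡ (^ᶠ-congˡ N z≈αᵏ) ⟩
      z · (α ^ᶠ k) ^ᶠ N    ≈⟨ *-congˡ (^ᶠ-assoc α k N) ⟩
      z · α ^ᶠ (k * N)     ≈⟨ *-congˡ (^ᶠ≈1∧∣⇒^ᶠ≈1 (proj₁ (proj₂ generator-hasOrder)) (divides k ≡.refl)) ⟩
      z · 1#               ≈⟨ *-identityʳ z ⟩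
      z                    ∎

module Frobenius {c ℓ : Level} (F : FiniteField c ℓ) where

  open import Data.Nat as ℕ using (zero; suc; z<s; s≤s)
  import Data.Nat.Properties as ℕₚ
  open import Data.Nat.Combinatorics using (nCn≡1)
  open import Data.Nat.Divisibility using (divides)
  open import Data.Fin as Fin using (toℕ)
  import Data.Fin.Properties as Finₚ
  open import Data.Fin.Permutation using (Permutation; permutation)
  open import Data.Vec.Functional using (init; last)
  open import Function.Base using (_∘_)
  open import Relation.Nullary using (yes; no; contradiction)
  import Relation.Binary.PropositionalEquality as ≡

  open FiniteField F renaming (_*_ to _·_)
  open FieldNotions F
  open FieldProperties F
  open import Algebra.Properties.CommutativeSemiring.Exp commutativeSemiring using () renaming (_^_ to _^ʳ_)
  import Algebra.Properties.CommutativeSemiring.Binomial commutativeSemiring as Binomial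
  open import Algebra.Properties.Semiring.Mult semiring
    using (×-homo-1; ×1-homo-*; ×-assoc-*; ×-congʳ) renaming (_×_ to _⊠_)
  open import Algebra.Properties.Semiring.Sum semiring
    using (sum; sum-permute; sum-cong-≋; ∑-distrib-+; sum-replicate; sum-init-last; sum-replicate-zero)
  open import Algebra.Properties.Group +-group using (identityʳ-unique; //-rightDividesˡ; //-rightDividesʳ)
  open import Relation.Binary.Reasoning.Setoid setoid

  private module E = Enumeration ≡.refl

  -- z ↦ z + 1 permutes F, so Σ z = Σ (z + 1) = Σ z + size ⊠ 1.
  size⊠1≈0 : size ⊠ 1# ≈ 0#
  size⊠1≈0 = identityʳ-unique (sum E.to) (size ⊠ 1#) (sym (begin
    sum E.to                                ≈⟨ sum-permute E.to translation ⟩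
    sum (λ i → E.to (E.from (E.to i + 1#)))  ≈⟨ sum-cong-≋ (λ i → E.strictlyInverseˡ (E.to i + 1#)) ⟩
    sum (λ i → E.to i + 1#)                 ≈⟨ ∑-distrib-+ {size} E.to (λ _ → 1#) ⟩
    sum E.to + sum {size} (λ _ → 1#)        ≈⟨ +-congˡ (sum-replicate size) ⟩
    sum E.to + size ⊠ 1#                    ∎))
    where
    translation : Permutation size size
    translation = permutation (λ i → E.from (E.to i + 1#)) (λ i → E.from (E.to i - 1#))
      (λ i → ≡.trans (E.from-cong (trans (+-congʳ (E.strictlyInverseˡ _)) (//-rightDividesˡ 1# (E.to i))))
                     (E.strictlyInverseʳ i))
      (λ i → ≡.trans (E.from-cong (trans (+-congʳ (E.strictlyInverseˡ _)) (//-rightDividesʳ 1# (E.to i))))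
                     (E.strictlyInverseʳ i))

  size≡p^k⇒p⊠1≈0 : ∀ {p k} → size ≡ p ^ k → p ⊠ 1# ≈ 0#
  size≡p^k⇒p⊠1≈0 {p} {k} size≡p^k with p ⊠ 1# ≟ 0#
  ... | yes p≈0 = p≈0
  ... | no  p≉0 = contradiction (begin
    (p ⊠ 1#) ^ᶠ k    ≈⟨ ^⊠1≈⊠1^ᶠ k ⟨
    (p ^ k) ⊠ 1#     ≡⟨ ≡.cong (_⊠ 1#) size≡p^k ⟨
    size ⊠ 1#        ≈⟨ size⊠1≈0 ⟩
    0#               ∎) (^ᶠ-≉0 k p≉0)
    where
    ^⊠1≈⊠1^ᶠ : ∀ k → (p ^ k) ⊠ 1# ≈ (p ⊠ 1#) ^ᶠ k
    ^⊠1≈⊠1^ᶠ zero    = ×-homo-1 1#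
    ^⊠1≈⊠1^ᶠ (suc k) = trans (×1-homo-* p (p ^ k)) (*-congˡ (^⊠1≈⊠1^ᶠ k))

  ∣⇒⊠≈0 : ∀ {p c} → p ⊠ 1# ≈ 0# → p ∣ c → ∀ x → c ⊠ x ≈ 0#
  ∣⇒⊠≈0 {p} p≈0 (divides d ≡.refl) x = begin
    (d * p) ⊠ x                   ≈⟨ ×-congʳ (d * p) (*-identityˡ x) ⟨
    (d * p) ⊠ (1# · x)            ≈⟨ ×-assoc-* (d * p) 1# x ⟨
    ((d * p) ⊠ 1#) · x            ≈⟨ *-congʳ (×1-homo-* d p) ⟩
    ((d ⊠ 1#) · (p ⊠ 1#)) · x     ≈⟨ *-congʳ (trans (*-congˡ p≈0) (zeroʳ _)) ⟩
    0# · x                        ≈⟨ zeroˡ x ⟩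
    0#                            ∎

  -- Only the two extreme binomial terms survive, since p ∣ p C k for 0 < k < p.
  frobenius-+ : ∀ {p} → Prime p → p ⊠ 1# ≈ 0# → ∀ x y → (x + y) ^ᶠ p ≈ x ^ᶠ p + y ^ᶠ p
  frobenius-+ {zero}  p-prime = contradiction (Arithmetic.prime⇒2≤ p-prime) λ ()
  frobenius-+ {suc p} p-prime p≈0 x y = begin
    (x + y) ^ᶠ suc p                                   ≈⟨ ^ᶠ≈^ʳ (x + y) (suc p) ⟩
    (x + y) ^ʳ suc p                                   ≈⟨ Binomial.theorem (suc p) x y ⟩
    term Fin.zero + sum (term ∘ Fin.suc)               ≈⟨ +-congˡ (sum-init-last (term ∘ Fin.suc)) ⟩
    term Fin.zero + (sum (init (term ∘ Fin.suc)) + last (term ∘ Fin.suc))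
      ≈⟨ +-cong first (+-cong (trans (sum-cong-≋ middle) (sum-replicate-zero p)) final) ⟩
    y ^ᶠ suc p + (0# + x ^ᶠ suc p)                     ≈⟨ trans (+-congˡ (+-identityˡ _)) (+-comm _ _) ⟩
    x ^ᶠ suc p + y ^ᶠ suc p                            ∎
    where
    term = Binomial.binomialTerm x y (suc p)
    first : term Fin.zero ≈ y ^ᶠ suc p
    first = trans (×-homo-1 _) (trans (*-identityˡ _) (sym (^ᶠ≈^ʳ y (suc p))))
    middle : ∀ i → term (Fin.suc (Fin.inject₁ i)) ≈ 0#
    middle i = ∣⇒⊠≈0 p≈0 (Arithmetic.prime∣choose p-prime (suc (toℕ (Fin.inject₁ i))) z<s
                           (s≤s (≡.subst (ℕ._< p) (≡.sym (Finₚ.toℕ-inject₁ i)) (Finₚ.toℕ<n i)))) _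
    final : last (term ∘ Fin.suc) ≈ x ^ᶠ suc p
    final rewrite Finₚ.toℕ-fromℕ p | nCn≡1 (suc p) | ℕₚ.n∸n≡0 p =
      trans (×-homo-1 _) (trans (*-identityʳ _) (sym (^ᶠ≈^ʳ x (suc p))))

  frobenius-+-^ : ∀ {p k} → Prime p → size ≡ p ^ k → ∀ s x y →
                  (x + y) ^ᶠ (p ^ s) ≈ x ^ᶠ (p ^ s) + y ^ᶠ (p ^ s)
  frobenius-+-^ p-prime size≡p^k zero    x y = distribʳ 1# x y
  frobenius-+-^ {p} {k} p-prime size≡p^k (suc s) x y = begin
    (x + y) ^ᶠ (p * p ^ s)                  ≈⟨ ^ᶠ-assoc (x + y) p (p ^ s) ⟨
    ((x + y) ^ᶠ p) ^ᶠ (p ^ s)               ≈⟨ ^ᶠ-congˡ (p ^ s) (frobenius-+ p-prime (size≡p^k⇒p⊠1≈0 {p} {k} size≡p^k) x y) ⟩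
    (x ^ᶠ p + y ^ᶠ p) ^ᶠ (p ^ s)            ≈⟨ frobenius-+-^ {p} {k} p-prime size≡p^k s _ _ ⟩
    (x ^ᶠ p) ^ᶠ (p ^ s) + (y ^ᶠ p) ^ᶠ (p ^ s) ≈⟨ +-cong (^ᶠ-assoc x p (p ^ s)) (^ᶠ-assoc y p (p ^ s)) ⟩
    x ^ᶠ (p * p ^ s) + y ^ᶠ (p * p ^ s)     ∎

  ^ᶠ-isSemiringEndomorphism : ∀ {q} → 0 < q → (∀ x y → (x + y) ^ᶠ q ≈ x ^ᶠ q + y ^ᶠ q) →
                              IsSemiringEndomorphism (_^ᶠ q)
  ^ᶠ-isSemiringEndomorphism {q} 0<q +-homo = record
    { isNearSemiringHomomorphism = record
      { +-isMonoidHomomorphism = record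
        { isMagmaHomomorphism = record
          { isRelHomomorphism = record { cong = ^ᶠ-congˡ q }
          ; homo = +-homo
          }
        ; ε-homo = 0^ᶠ 0<q
        }
      ; *-homo = λ x y → ^ᶠ-distrib-· x y q
      }
    ; 1#-homo = 1^ᶠ q
    }

module Polynomials {c ℓ : Level} (F : FiniteField c ℓ) where

  open import Data.Nat as ℕ using (zero; suc)
  import Data.Nat.Properties as ℕₚ
  open import Data.Fin as Fin using (Fin)
  import Data.Fin.Properties as Finₚ
  open import Data.List using (List; []; _∷_; _++_; length; map)
  open import Data.List.Relation.Unary.All using (All; []; _∷_)
  open import Data.List.Relation.Binary.Pointwise using ([]; _∷_)
  open import Function.Base using (_∘_)
  open import Relation.Nullary using (yes; no; contradiction)
  import Relation.Binary.PropositionalEquality as ≡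
  open import Algebra.Morphism.Structures using (module SemiringMorphisms)
  open SemiringMorphisms using (IsSemiringHomomorphism)

  open FiniteField F renaming (_*_ to _·_)
  open FieldNotions F
  open FieldProperties F using (IsSemiringEndomorphism; _≟_; ·-cancelˡ)
  open import Relation.Binary.Reasoning.Setoid setoid
  open import Algebra.Solver.Ring.NaturalCoefficients.Default commutativeSemiring using (solve; _:+_; _:*_; _:=_)

  x+y·0≈x : ∀ x y → x + y · 0# ≈ x
  x+y·0≈x x y = trans (+-congˡ (zeroʳ y)) (+-identityʳ x)

  coeff : Poly → ℕ → Carrier
  coeff []      i       = 0#
  coeff (a ∷ P) zero    = a
  coeff (a ∷ P) (suc i) = coeff P i

  infix 4 _≋_
  record _≋_ (P Q : Poly) : Set ℓ where
    constructor mk≋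
    field coeff-≈ : ∀ i → coeff P i ≈ coeff Q i
  open _≋_ public

  ≋-refl : ∀ {P} → P ≋ P
  ≋-refl = mk≋ λ _ → refl

  ≋-trans : ∀ {P Q R} → P ≋ Q → Q ≋ R → P ≋ R
  ≋-trans P≋Q Q≋R = mk≋ λ i → trans (coeff-≈ P≋Q i) (coeff-≈ Q≋R i)

  coeff-All : ∀ {r} {R : Carrier → Set r} P → (∀ i → R (coeff P i)) → All R P
  coeff-All []      R-coeff = []
  coeff-All (a ∷ P) R-coeff = R-coeff 0 ∷ coeff-All P (R-coeff ∘ suc)

  eval-cong : ∀ f {x y} → x ≈ y → eval f x ≈ eval f y
  eval-cong []      x≈y = refl
  eval-cong (a ∷ f) x≈y = +-congˡ (*-cong x≈y (eval-cong f x≈y))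

  eval-pointwise : ∀ {f g} → Pointwise _≈_ f g → ∀ z → eval f z ≈ eval g z
  eval-pointwise []            z = refl
  eval-pointwise (a≈b ∷ f≈g) z = +-cong a≈b (*-congˡ (eval-pointwise f≈g z))

  -- mulLinear′ c a P = (a + X P) − c P; in particular mulLinear c P = (X − c) P.
  mulLinear′ : Carrier → Carrier → Poly → Poly
  mulLinear′ c a []      = a ∷ []
  mulLinear′ c a (b ∷ P) = (a + (- c) · b) ∷ mulLinear′ c b P

  mulLinear : Carrier → Poly → Poly
  mulLinear c = mulLinear′ c 0#

  linearProduct : List Carrier → Poly
  linearProduct []       = 1# ∷ []
  linearProduct (c ∷ cs) = mulLinear c (linearProduct cs)

  coeff-mulLinear′ : ∀ c a P i → coeff (mulLinear′ c a P) i ≈ coeff (a ∷ P) i + (- c) · coeff P i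
  coeff-mulLinear′ c a []      zero    = sym (x+y·0≈x a (- c))
  coeff-mulLinear′ c a []      (suc i) = sym (x+y·0≈x 0# (- c))
  coeff-mulLinear′ c a (b ∷ P) zero    = refl
  coeff-mulLinear′ c a (b ∷ P) (suc i) = coeff-mulLinear′ c b P i

  mulLinear′-cong : ∀ {c d a b P Q} → c ≈ d → a ≈ b → P ≋ Q → mulLinear′ c a P ≋ mulLinear′ d b Q
  mulLinear′-cong {c} {d} {a} {b} {P} {Q} c≈d a≈b P≋Q = mk≋ λ i → begin
    coeff (mulLinear′ c a P) i              ≈⟨ coeff-mulLinear′ c a P i ⟩
    coeff (a ∷ P) i + (- c) · coeff P i     ≈⟨ +-cong (a∷P≋b∷Q i) (*-cong (-‿cong c≈d) (coeff-≈ P≋Q i)) ⟩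
    coeff (b ∷ Q) i + (- d) · coeff Q i     ≈⟨ coeff-mulLinear′ d b Q i ⟨
    coeff (mulLinear′ d b Q) i              ∎
    where
    a∷P≋b∷Q : ∀ i → coeff (a ∷ P) i ≈ coeff (b ∷ Q) i
    a∷P≋b∷Q zero    = a≈b
    a∷P≋b∷Q (suc i) = coeff-≈ P≋Q i

  mulLinear-comm : ∀ a b P → mulLinear a (mulLinear b P) ≋ mulLinear b (mulLinear a P)
  mulLinear-comm a b P = mk≋ λ i → begin
    coeff (mulLinear a (mulLinear b P)) i  ≈⟨ expand a b i ⟩
    (P₂ i + (- b) · P₁ i) + (- a) · (P₁ i + (- b) · P₀ i)  ≈⟨ swap (- a) (- b) (P₂ i) (P₁ i) (P₀ i) ⟩
    (P₂ i + (- a) · P₁ i) + (- b) · (P₁ i + (- a) · P₀ i)  ≈⟨ expand b a i ⟨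
    coeff (mulLinear b (mulLinear a P)) i  ∎
    where
    P₀ P₁ P₂ : ℕ → Carrier
    P₀ = coeff P
    P₁ = coeff (0# ∷ P)
    P₂ = coeff (0# ∷ 0# ∷ P)
    coeff-0∷mulLinear : ∀ c i → coeff (0# ∷ mulLinear c P) i ≈ P₂ i + (- c) · P₁ i
    coeff-0∷mulLinear c zero    = sym (trans (+-identityˡ _) (zeroʳ _))
    coeff-0∷mulLinear c (suc i) = coeff-mulLinear′ c 0# P i
    expand : ∀ a b i → coeff (mulLinear a (mulLinear b P)) i ≈ (P₂ i + (- b) · P₁ i) + (- a) · (P₁ i + (- b) · P₀ i)
    expand a b i = trans (coeff-mulLinear′ a 0# (mulLinear b P) i)
                         (+-cong (coeff-0∷mulLinear b i) (*-congˡ (coeff-mulLinear′ b 0# P i)))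
    swap : ∀ a b x y z → (x + b · y) + a · (y + b · z) ≈ (x + a · y) + b · (y + a · z)
    swap = solve 5 (λ a b x y z → (x :+ b :* y) :+ a :* (y :+ b :* z) := (x :+ a :* y) :+ b :* (y :+ a :* z)) refl

  linearProduct-cong : ∀ {cs ds} → Pointwise _≈_ cs ds → linearProduct cs ≋ linearProduct ds
  linearProduct-cong []            = ≋-refl
  linearProduct-cong (c≈d ∷ cs≈ds) = mulLinear′-cong c≈d refl (linearProduct-cong cs≈ds)

  linearProduct-rotate : ∀ cs c → linearProduct (cs ++ c ∷ []) ≋ linearProduct (c ∷ cs)
  linearProduct-rotate []       c = ≋-refl
  linearProduct-rotate (d ∷ cs) c = ≋-trans (mulLinear′-cong refl refl (linearProduct-rotate cs c))
                                            (mulLinear-comm d c (linearProduct cs))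

  eval-mulLinear′ : ∀ c a P z → eval (mulLinear′ c a P) z ≈ a + (z + - c) · eval P z
  eval-mulLinear′ c a []      z = trans (x+y·0≈x a z) (sym (x+y·0≈x a (z + - c)))
  eval-mulLinear′ c a (b ∷ P) z = trans (+-congˡ (*-congˡ (eval-mulLinear′ c b P z)))
                                        (regroup a (- c) b z (eval P z))
    where
    regroup : ∀ a c b z E → (a + c · b) + z · (b + (z + c) · E) ≈ a + (z + c) · (b + z · E)
    regroup = solve 5 (λ a c b z E → (a :+ c :* b) :+ z :* (b :+ (z :+ c) :* E) := a :+ (z :+ c) :* (b :+ z :* E)) refl

  linearProduct-root : ∀ c cs → eval (linearProduct (c ∷ cs)) c ≈ 0#
  linearProduct-root c cs = begin
    eval (linearProduct (c ∷ cs)) c              ≈⟨ eval-mulLinear′ c 0# (linearProduct cs) c ⟩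
    0# + (c + - c) · eval (linearProduct cs) c   ≈⟨ +-identityˡ _ ⟩
    (c + - c) · eval (linearProduct cs) c        ≈⟨ *-congʳ (-‿inverseʳ c) ⟩
    0# · eval (linearProduct cs) c               ≈⟨ zeroˡ _ ⟩
    0#                                           ∎

  monic-mulLinear′ : ∀ c a P → Monic P → Monic (mulLinear′ c a P)
  monic-mulLinear′ c a (b ∷ [])     monic = monic
  monic-mulLinear′ c a (b ∷ d ∷ P) monic = monic-mulLinear′ c b (d ∷ P) monic

  monic-linearProduct : ∀ cs → Monic (linearProduct cs)
  monic-linearProduct []       = refl
  monic-linearProduct (c ∷ cs) = monic-mulLinear′ c 0# (linearProduct cs) (monic-linearProduct cs)

  length-mulLinear′ : ∀ c a P → length (mulLinear′ c a P) ≡ suc (length P)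
  length-mulLinear′ c a []      = ≡.refl
  length-mulLinear′ c a (b ∷ P) = ≡.cong suc (length-mulLinear′ c b P)

  length-linearProduct : ∀ cs → length (linearProduct cs) ≡ suc (length cs)
  length-linearProduct []       = ≡.refl
  length-linearProduct (c ∷ cs) = ≡.trans (length-mulLinear′ c 0# (linearProduct cs)) (≡.cong suc (length-linearProduct cs))

  module _ {φ : Carrier → Carrier} (φ-homo : IsSemiringEndomorphism φ) where

    open IsSemiringHomomorphism φ-homo

    φ-neg : ∀ x → φ (- x) ≈ - φ x
    φ-neg x = inverseˡ-unique (φ (- x)) (φ x) (begin
      φ (- x) + φ x    ≈⟨ +-homo (- x) x ⟨
      φ (- x + x)      ≈⟨ ⟦⟧-cong (-‿inverseˡ x) ⟩
      φ 0#             ≈⟨ 0#-homo ⟩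
      0#               ∎)
      where open import Algebra.Properties.Group +-group using (inverseˡ-unique)

    coeff-map : ∀ P i → coeff (map φ P) i ≈ φ (coeff P i)
    coeff-map []      i       = sym 0#-homo
    coeff-map (a ∷ P) zero    = refl
    coeff-map (a ∷ P) (suc i) = coeff-map P i

    map-mulLinear′ : ∀ c a P → map φ (mulLinear′ c a P) ≋ mulLinear′ (φ c) (φ a) (map φ P)
    map-mulLinear′ c a P = mk≋ λ i → begin
      coeff (map φ (mulLinear′ c a P)) i                  ≈⟨ coeff-map (mulLinear′ c a P) i ⟩
      φ (coeff (mulLinear′ c a P) i)                      ≈⟨ ⟦⟧-cong (coeff-mulLinear′ c a P i) ⟩
      φ (coeff (a ∷ P) i + (- c) · coeff P i)             ≈⟨ trans (+-homo _ _) (+-congˡ (*-homo _ _)) ⟩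
      φ (coeff (a ∷ P) i) + φ (- c) · φ (coeff P i)       ≈⟨ +-cong (sym (coeff-map (a ∷ P) i)) (*-cong (φ-neg c) (sym (coeff-map P i))) ⟩
      coeff (map φ (a ∷ P)) i + (- φ c) · coeff (map φ P) i ≈⟨ coeff-mulLinear′ (φ c) (φ a) (map φ P) i ⟨
      coeff (mulLinear′ (φ c) (φ a) (map φ P)) i          ∎

    map-linearProduct : ∀ cs → map φ (linearProduct cs) ≋ linearProduct (map φ cs)
    map-linearProduct []       = mk≋ λ { zero → 1#-homo ; (suc zero) → refl ; (suc (suc i)) → refl }
    map-linearProduct (c ∷ cs) = ≋-trans (map-mulLinear′ c 0# (linearProduct cs))
                                         (mulLinear′-cong refl 0#-homo (map-linearProduct cs))

    eval-fixed : ∀ f z → All (λ a → φ a ≈ a) f → eval f (φ z) ≈ φ (eval f z)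
    eval-fixed []      z []              = sym 0#-homo
    eval-fixed (a ∷ f) z (φa≈a ∷ φf≈f) = sym (begin
      φ (a + z · eval f z)              ≈⟨ +-homo _ _ ⟩
      φ a + φ (z · eval f z)            ≈⟨ +-cong φa≈a (*-homo _ _) ⟩
      a + φ z · φ (eval f z)            ≈⟨ +-congˡ (*-congˡ (eval-fixed f z φf≈f)) ⟨
      a + φ z · eval f (φ z)            ∎)

  divideLinear : Carrier → Poly → Poly
  divideLinear z₀ []          = []
  divideLinear z₀ (a ∷ [])    = []
  divideLinear z₀ (a ∷ b ∷ P) = eval (b ∷ P) z₀ ∷ divideLinear z₀ (b ∷ P)

  -- P(z) − P(z₀) = (z − z₀) Q(z) for Q = divideLinear z₀ P, written without subtraction.
  eval-divideLinear : ∀ z₀ P z → eval P z + z₀ · eval (divideLinear z₀ P) z ≈ eval P z₀ + z · eval (divideLinear z₀ P) z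
  eval-divideLinear z₀ []          z = trans (x+y·0≈x 0# z₀) (sym (x+y·0≈x 0# z))
  eval-divideLinear z₀ (a ∷ [])    z = trans (x+y·0≈x _ z₀) (trans (x+y·0≈x a z) (sym (trans (x+y·0≈x _ z) (x+y·0≈x a z₀))))
  eval-divideLinear z₀ (a ∷ b ∷ P) z = trans (exchange a z _ z₀ _ _) (+-congˡ (*-congˡ (eval-divideLinear z₀ (b ∷ P) z)))
    where
    exchange : ∀ a z B z₀ B₀ Q → (a + z · B) + z₀ · (B₀ + z · Q) ≈ (a + z₀ · B₀) + z · (B + z₀ · Q)
    exchange = solve 6 (λ a z B z₀ B₀ Q → (a :+ z :* B) :+ z₀ :* (B₀ :+ z :* Q) := (a :+ z₀ :* B₀) :+ z :* (B :+ z₀ :* Q)) refl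

  length-divideLinear : ∀ z₀ P → length (divideLinear z₀ P) ≡ ℕ.pred (length P)
  length-divideLinear z₀ []          = ≡.refl
  length-divideLinear z₀ (a ∷ [])    = ≡.refl
  length-divideLinear z₀ (a ∷ b ∷ P) = ≡.cong suc (length-divideLinear z₀ (b ∷ P))

  divideLinear-zero : ∀ z₀ P → All (_≈ 0#) (divideLinear z₀ P) → eval P z₀ ≈ 0# → All (_≈ 0#) P
  divideLinear-zero z₀ []          _            _      = []
  divideLinear-zero z₀ (a ∷ [])    _            Pz₀≈0 = trans (sym (x+y·0≈x a z₀)) Pz₀≈0 ∷ []
  divideLinear-zero z₀ (a ∷ b ∷ P) (Q₀≈0 ∷ Q≈0) Pz₀≈0 =
    trans (sym (x+y·0≈x a z₀)) (trans (+-congˡ (*-congˡ (sym Q₀≈0))) Pz₀≈0) ∷ divideLinear-zero z₀ (b ∷ P) Q≈0 Q₀≈0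

  x≉y∧x·z≈y·z⇒z≈0 : ∀ {x y z} → x ≉ y → x · z ≈ y · z → z ≈ 0#
  x≉y∧x·z≈y·z⇒z≈0 {x} {y} {z} x≉y xz≈yz with z ≟ 0#
  ... | yes z≈0 = z≈0
  ... | no  z≉0 = contradiction (·-cancelˡ z≉0 (trans (*-comm z x) (trans xz≈yz (*-comm y z)))) x≉y

  distinctRoots⇒zero : ∀ k P (zs : Fin k → Carrier) → (∀ {i j} → zs i ≈ zs j → i ≡ j) →
                       (∀ i → eval P (zs i) ≈ 0#) → length P ℕ.≤ k → All (_≈ 0#) P
  distinctRoots⇒zero zero    []  zs zs-injective roots _ = []
  distinctRoots⇒zero (suc k) P zs zs-injective roots length≤ =
    divideLinear-zero z₀ P
      (distinctRoots⇒zero k Q (zs ∘ Fin.suc) (Finₚ.suc-injective ∘ zs-injective) Q-roots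
        (≡.subst (ℕ._≤ k) (≡.sym (length-divideLinear z₀ P)) (ℕₚ.pred-mono-≤ length≤)))
      (roots Fin.zero)
    where
    z₀ = zs Fin.zero
    Q = divideLinear z₀ P
    Q-roots : ∀ i → eval Q (zs (Fin.suc i)) ≈ 0#
    Q-roots i = x≉y∧x·z≈y·z⇒z≈0 (Finₚ.0≢1+n ∘ zs-injective) (begin
      z₀ · eval Q zᵢ                ≈⟨ +-identityˡ _ ⟨
      0# + z₀ · eval Q zᵢ           ≈⟨ +-congʳ (roots (Fin.suc i)) ⟨
      eval P zᵢ + z₀ · eval Q zᵢ    ≈⟨ eval-divideLinear z₀ P zᵢ ⟩
      eval P z₀ + zᵢ · eval Q zᵢ    ≈⟨ +-congʳ (roots Fin.zero) ⟩
      0# + zᵢ · eval Q zᵢ           ≈⟨ +-identityˡ _ ⟩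
      zᵢ · eval Q zᵢ                ∎)
      where zᵢ = zs (Fin.suc i)

  monic⇒¬zero : ∀ f → Monic f → ¬ All (_≈ 0#) f
  monic⇒¬zero (a ∷ [])     a≈1     (a≈0 ∷ []) = 1≉0 (trans (sym a≈1) a≈0)
  monic⇒¬zero (a ∷ b ∷ f) monic   (_ ∷ f≈0)  = monic⇒¬zero (b ∷ f) monic f≈0

module MinimalPolynomials {c ℓ : Level} (F : FiniteField c ℓ) where

  open import Data.Nat as ℕ using (zero; suc)
  import Data.Nat.Properties as ℕₚ
  open import Data.Fin as Fin using (Fin; toℕ)
  import Data.Fin.Properties as Finₚ
  open import Data.Product using (_,_)
  open import Data.List using (List; []; _∷_; _++_; length; map)
  open import Data.List.Relation.Unary.All using (All)
  open import Data.List.Relation.Binary.Pointwise as PW using ([]; _∷_)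
  open import Relation.Nullary using (contradiction)
  import Relation.Binary.PropositionalEquality as ≡
  open import Algebra.Morphism.Structures using (module SemiringMorphisms)
  open SemiringMorphisms using (IsSemiringHomomorphism)

  open FiniteField F renaming (_*_ to _·_)
  open FieldNotions F
  open FieldProperties F
  open Polynomials F
  open import Relation.Binary.Reasoning.Setoid setoid

  module Conjugates {q : ℕ} (φ-homo : IsSemiringEndomorphism (_^ᶠ q)) (x : Carrier) where

    conjugate : ℕ → Carrier
    conjugate i = x ^ᶠ (q ^ i)

    conjugates : ℕ → ℕ → List Carrier
    conjugates i zero    = []
    conjugates i (suc k) = conjugate i ∷ conjugates (suc i) k

    conjugate-zero : conjugate 0 ≈ x
    conjugate-zero = *-identityʳ x

    conjugate-suc : ∀ i → conjugate i ^ᶠ q ≈ conjugate (suc i)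
    conjugate-suc i = trans (^ᶠ-assoc x (q ^ i) q) (^ᶠ-congʳ x (ℕₚ.*-comm (q ^ i) q))

    conjugate-root : ∀ {f} → All (InGF q) f → eval f x ≈ 0# → ∀ i → eval f (conjugate i) ≈ 0#
    conjugate-root {f} f∈GF fx≈0 zero    = trans (eval-cong f conjugate-zero) fx≈0
    conjugate-root {f} f∈GF fx≈0 (suc i) = begin
      eval f (conjugate (suc i))        ≈⟨ eval-cong f (conjugate-suc i) ⟨
      eval f (conjugate i ^ᶠ q)         ≈⟨ eval-fixed φ-homo f (conjugate i) f∈GF ⟩
      eval f (conjugate i) ^ᶠ q         ≈⟨ ^ᶠ-congˡ q (conjugate-root f∈GF fx≈0 i) ⟩
      0# ^ᶠ q                           ≈⟨ IsSemiringHomomorphism.0#-homo φ-homo ⟩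
      0#                                ∎

    length-conjugates : ∀ i k → length (conjugates i k) ≡ k
    length-conjugates i zero    = ≡.refl
    length-conjugates i (suc k) = ≡.cong suc (length-conjugates (suc i) k)

    map-conjugates : ∀ i k j → suc (k ℕ.+ i) ≡ j →
                     Pointwise _≈_ (map (_^ᶠ q) (conjugates i (suc k))) (conjugates (suc i) k ++ conjugate j ∷ [])
    map-conjugates i zero    j ≡.refl = conjugate-suc i ∷ []
    map-conjugates i (suc k) j k+i≡j  = conjugate-suc i ∷ map-conjugates (suc i) k j (≡.trans (≡.cong suc (ℕₚ.+-suc k i)) k+i≡j)

    module _ {m : ℕ} (0<m : 0 < m) (x^qᵐ≈x : x ^ᶠ (q ^ m) ≈ x) where

      conjugatePolynomial : Poly
      conjugatePolynomial = linearProduct (conjugates 0 m)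

      -- z ↦ z^q permutes the roots cyclically because x^(q^m) = x.
      conjugatePolynomial-fixed : map (_^ᶠ q) conjugatePolynomial ≋ conjugatePolynomial
      conjugatePolynomial-fixed = fixed 0<m x^qᵐ≈x
        where
        fixed : ∀ {k} → 0 < k → x ^ᶠ (q ^ k) ≈ x →
                map (_^ᶠ q) (linearProduct (conjugates 0 k)) ≋ linearProduct (conjugates 0 k)
        fixed {suc k} _ x^qᵏ≈x =
          ≋-trans (map-linearProduct φ-homo (conjugates 0 (suc k)))
          (≋-trans (linearProduct-cong (map-conjugates 0 k (suc k) (≡.cong suc (ℕₚ.+-identityʳ k))))
          (≋-trans (linearProduct-rotate (conjugates 1 k) (conjugate (suc k)))
                   (linearProduct-cong {conjugate (suc k) ∷ conjugates 1 k}
                                       (trans x^qᵏ≈x (sym conjugate-zero) ∷ PW.refl refl))))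

      conjugatePolynomial∈GF : All (InGF q) conjugatePolynomial
      conjugatePolynomial∈GF = coeff-All conjugatePolynomial λ i →
        trans (sym (coeff-map φ-homo conjugatePolynomial i)) (coeff-≈ conjugatePolynomial-fixed i)

      conjugatePolynomial-root : eval conjugatePolynomial x ≈ 0#
      conjugatePolynomial-root = root 0<m
        where
        root : ∀ {k} → 0 < k → eval (linearProduct (conjugates 0 k)) x ≈ 0#
        root {suc k} _ = trans (eval-cong (linearProduct (conjugates 0 (suc k))) (sym conjugate-zero))
                               (linearProduct-root (conjugate 0) (conjugates 1 k))

      minimalPolynomial-length : ∀ {f} → IsMinimalPolynomial q x f → length f ℕ.≤ suc m
      minimalPolynomial-length {f} (_ , _ , _ , minimal) = ≡.subst (length f ℕ.≤_) length≡
        (minimal conjugatePolynomial (monic-linearProduct (conjugates 0 m)) conjugatePolynomial∈GF conjugatePolynomial-root)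
        where
        length≡ : length conjugatePolynomial ≡ suc m
        length≡ = ≡.trans (length-linearProduct (conjugates 0 m)) (≡.cong suc (length-conjugates 0 m))

      minimalPolynomials-differ : (∀ {i j} → i ℕ.< m → j ℕ.< m → conjugate i ≈ conjugate j → i ≡ j) →
                                  ∀ {y} → (∀ j → j ℕ.< m → y ≉ conjugate j) →
                                  ∀ {f₁ f₂} → IsMinimalPolynomial q x f₁ → IsMinimalPolynomial q y f₂ →
                                  ¬ Pointwise _≈_ f₁ f₂
      minimalPolynomials-differ conjugate-injective {y} y≉conjugate {f₁}
                                f₁-minimal@(f₁-monic , f₁∈GF , f₁x≈0 , _) (_ , _ , f₂y≈0 , _) f₁≈f₂ =
        monic⇒¬zero f₁ f₁-monic
          (distinctRoots⇒zero (suc m) f₁ roots roots-injective roots-vanish (minimalPolynomial-length f₁-minimal))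
        where
        roots : Fin (suc m) → Carrier
        roots Fin.zero    = y
        roots (Fin.suc j) = conjugate (toℕ j)
        roots-vanish : ∀ i → eval f₁ (roots i) ≈ 0#
        roots-vanish Fin.zero    = trans (eval-pointwise f₁≈f₂ y) f₂y≈0
        roots-vanish (Fin.suc j) = conjugate-root f₁∈GF f₁x≈0 (toℕ j)
        roots-injective : ∀ {i j} → roots i ≈ roots j → i ≡ j
        roots-injective {Fin.zero}  {Fin.zero}  _   = ≡.refl
        roots-injective {Fin.zero}  {Fin.suc j} y≈  = contradiction y≈ (y≉conjugate (toℕ j) (Finₚ.toℕ<n j))
        roots-injective {Fin.suc i} {Fin.zero}  ≈y  = contradiction (sym ≈y) (y≉conjugate (toℕ i) (Finₚ.toℕ<n i))
        roots-injective {Fin.suc i} {Fin.suc j} i≈j =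
          ≡.cong Fin.suc (Finₚ.toℕ-injective (conjugate-injective (Finₚ.toℕ<n i) (Finₚ.toℕ<n j) i≈j))

module Setting {c ℓ : Level} (F : FiniteField c ℓ) (p s m : ℕ) (p-prime : Prime p) (0<s : 0 < s) (0<m : 0 < m)
               (size≡qᵐ : FiniteField.size F ≡ (p ^ s) ^ m)
               (α : FiniteField.Carrier F) (α-generator : FieldNotions.IsGenerator F α)
               (h : ℕ) (0<h : 0 < h) (h∣q∸1 : h ∣ p ^ s ∸ 1)
               (e : ℕ) (1<e : 1 < e) (e∣gcd : e ∣ gcd (p ^ s ∸ 1) (h * m))
               (a : ℕ) (a*h≡q∸1 : a * h ≡ p ^ s ∸ 1)
               (n : ℕ) (n*[q∸1]≡h*[qᵐ∸1] : n * (p ^ s ∸ 1) ≡ h * ((p ^ s) ^ m ∸ 1))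
               (t : ℕ) (t*e≡qᵐ∸1 : t * e ≡ (p ^ s) ^ m ∸ 1) where

  open import Data.Nat using (suc; _≤_; >-nonZero)
  import Data.Nat as ℕ
  import Data.Nat.Properties as ℕₚ
  open import Data.Nat.Primality using (prime⇒nonZero)
  open import Relation.Binary.Definitions using (tri<; tri≈; tri>)
  open import Data.Nat.Divisibility using (∣-trans; *-monoʳ-∣)
  open import Data.Nat.GCD using (gcd[m,n]∣m; gcd[m,n]∣n)
  open import Data.Product using (proj₁; proj₂)
  open import Relation.Nullary using (contradiction)
  open import Relation.Binary.PropositionalEquality as ≡ using (subst)
  open FiniteField F renaming (_*_ to _·_)
  open FieldNotions F
  open FieldProperties F
  open Frobenius F using (frobenius-+-^; ^ᶠ-isSemiringEndomorphism)
  open Arithmetic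
  open import Relation.Binary.Reasoning.Setoid setoid

  q N : ℕ
  q = p ^ s
  N = q ^ m ∸ 1

  g β : Carrier
  g = α ^ᶠ a
  β = α ^ᶠ t

  2≤q : 2 ≤ q
  2≤q = ℕₚ.≤-trans (prime⇒2≤ p-prime) (subst (_≤ q) (ℕₚ.*-identityʳ p) (ℕₚ.^-monoʳ-≤ p {{prime⇒nonZero p-prime}} 0<s))

  0<q : 0 < q
  0<q = ℕₚ.<⇒≤ 2≤q

  size≡1+N : size ≡ suc N
  size≡1+N = ≡.trans size≡qᵐ (≡.sym (ℕₚ.m+[n∸m]≡n (ℕₚ.m^n>0 q {{>-nonZero 0<q}} m)))

  α-order : HasOrder α N
  α-order = Generator.generator-hasOrder size≡1+N α-generator

  a*n≡N : a * n ≡ N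
  a*n≡N = a*h≡q∸1⇒a*n≡q^m∸1 {q} {m} {h} {n} {a} 0<h n*[q∸1]≡h*[qᵐ∸1] a*h≡q∸1

  0<N : 0 < N
  0<N = 0<q^m∸1 q m 2≤q 0<m

  0<a : 0 < a
  0<a = 0<m*n⇒0<m a (subst (0 <_) (≡.sym a*n≡N) 0<N)

  t<N : t < N
  t<N = subst (t <_) t*e≡qᵐ∸1
          (ℕₚ.m<m*n t e {{>-nonZero (0<m*n⇒0<m t (subst (0 <_) (≡.sym t*e≡qᵐ∸1) 0<N))}} 1<e)

  g-order : HasOrder g n
  g-order = hasOrder-^ᶠ a 0<a (subst (HasOrder α) (≡.sym a*n≡N) α-order)

  e∣q∸1 : e ∣ q ∸ 1
  e∣q∸1 = ∣-trans e∣gcd (gcd[m,n]∣m (q ∸ 1) (h * m))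

  e∣n : e ∣ n
  e∣n = ∣[q∸1]∧∣hm⇒∣n {q} {m} {h} {n} 2≤q n*[q∸1]≡h*[qᵐ∸1] e∣q∸1 (∣-trans e∣gcd (gcd[m,n]∣n (q ∸ 1) (h * m)))

  gβ^n≈1 : (g · β) ^ᶠ n ≈ 1#
  gβ^n≈1 = begin
    (g · β) ^ᶠ n       ≈⟨ ^ᶠ-distrib-· g β n ⟩
    g ^ᶠ n · β ^ᶠ n    ≈⟨ *-cong (proj₁ (proj₂ g-order)) (^ᶠ-assoc α t n) ⟩
    1# · α ^ᶠ (t * n)  ≈⟨ *-identityˡ _ ⟩
    α ^ᶠ (t * n)       ≈⟨ ^ᶠ≈1∧∣⇒^ᶠ≈1 (proj₁ (proj₂ α-order)) (subst (_∣ t * n) t*e≡qᵐ∸1 (*-monoʳ-∣ t e∣n)) ⟩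
    1#                 ∎

  g≉0 : g ≉ 0#
  g≉0 = hasOrder⇒≉0 g-order

  x y : Carrier
  x = g ⁻¹
  y = (β · g) ⁻¹

  open MinimalPolynomials F using (module Conjugates)
  open Conjugates {q} (^ᶠ-isSemiringEndomorphism 0<q (frobenius-+-^ {k = s * m} p-prime (≡.trans size≡qᵐ (ℕₚ.^-*-assoc p s m)) s)) x

  x^qᵐ≈x : x ^ᶠ (q ^ m) ≈ x
  x^qᵐ≈x = trans (^ᶠ-congʳ x (≡.trans (≡.sym size≡qᵐ) size≡1+N)) (Generator.^ᶠ-size≈id size≡1+N α-generator x)

  x^[q^E]≉x : ∀ {E} → 0 < E → E < m → x ^ᶠ (q ^ E) ≉ x
  x^[q^E]≉x {E} 0<E E<m x^qᴱ≈x = proj₂ (proj₂ g-order) (q ^ E ∸ 1) (0<q^m∸1 q E 2≤q 0<E)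
    (q^j∸1<n 2≤q 0<h n*[q∸1]≡h*[qᵐ∸1] E<m)
    (⁻¹-^ᶠ≈1⇒^ᶠ≈1 (q ^ E ∸ 1) g≉0
      (^ᶠ≈^ᶠ⇒^ᶠ∸≈1 (x⁻¹≉0 g≉0) (ℕₚ.m^n>0 q {{>-nonZero 0<q}} E) (trans (*-identityʳ x) (sym x^qᴱ≈x))))

  conjugate-distinct : ∀ {i j} → i < j → j < m → conjugate i ≉ conjugate j
  conjugate-distinct {i} {j} i<j j<m cᵢ≈cⱼ = x^[q^E]≉x {i ℕ.+ k} (ℕₚ.<-≤-trans 0<k (ℕₚ.m≤n+m k i)) i+k<m (begin
    x ^ᶠ (q ^ (i ℕ.+ k))         ≈⟨ ^ᶠ-congʳ x (ℕₚ.^-distribˡ-+-* q i k) ⟩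
    x ^ᶠ (q ^ i * q ^ k)         ≈⟨ ^ᶠ-assoc x (q ^ i) (q ^ k) ⟨
    conjugate i ^ᶠ (q ^ k)       ≈⟨ ^ᶠ-congˡ (q ^ k) cᵢ≈cⱼ ⟩
    conjugate j ^ᶠ (q ^ k)       ≈⟨ ^ᶠ-assoc x (q ^ j) (q ^ k) ⟩
    x ^ᶠ (q ^ j * q ^ k)         ≈⟨ ^ᶠ-congʳ x (≡.trans (≡.sym (ℕₚ.^-distribˡ-+-* q j k)) (≡.cong (q ^_) j+k≡m)) ⟩
    x ^ᶠ (q ^ m)                 ≈⟨ x^qᵐ≈x ⟩
    x                            ∎)
    where
    k = m ∸ j
    0<k : 0 < k
    0<k = ℕₚ.m<n⇒0<n∸m j<m
    j+k≡m : j ℕ.+ k ≡ m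
    j+k≡m = ℕₚ.m+[n∸m]≡n (ℕₚ.<⇒≤ j<m)
    i+k<m : i ℕ.+ k < m
    i+k<m = subst (i ℕ.+ k <_) j+k≡m (ℕₚ.+-monoˡ-< k i<j)

  conjugate-injective : ∀ {i j} → i < m → j < m → conjugate i ≈ conjugate j → i ≡ j
  conjugate-injective {i} {j} i<m j<m cᵢ≈cⱼ with ℕₚ.<-cmp i j
  ... | tri< i<j _ _ = contradiction cᵢ≈cⱼ (conjugate-distinct i<j j<m)
  ... | tri≈ _ i≡j _ = i≡j
  ... | tri> _ _ j<i = contradiction (sym cᵢ≈cⱼ) (conjugate-distinct j<i i<m)

  y≉conjugate : ¬ (q ≡ 3 × h ≡ 1 × e ≡ 2 × m ≡ 2) → ∀ j → j < m → y ≉ conjugate j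
  y≉conjugate not-exceptional j j<m y≈cⱼ =
    not-exceptional (t≡a*[q^j∸1]⇒exceptional {a = a} 2≤q 1<e e∣q∸1 0<h h∣q∸1 j<m a*h≡q∸1 t*e≡qᵐ∸1 t≡aX)
    where
    X = q ^ j ∸ 1
    β≉0 : β ≉ 0#
    β≉0 = ^ᶠ-≉0 t (hasOrder⇒≉0 α-order)
    βg≈g^qʲ : β · g ≈ g ^ᶠ (q ^ j)
    βg≈g^qʲ = ⁻¹-injective (x≉0∧y≉0⇒x·y≉0 β≉0 g≉0) (^ᶠ-≉0 (q ^ j) g≉0) (trans y≈cⱼ (⁻¹-^ᶠ (q ^ j) g≉0))
    a*q^j≡a+a*X : a * q ^ j ≡ a ℕ.+ a * X
    a*q^j≡a+a*X = ≡.trans (≡.cong (a *_) (≡.sym (ℕₚ.m+[n∸m]≡n (ℕₚ.m^n>0 q {{>-nonZero 0<q}} j)))) (ℕₚ.*-suc a X)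
    β≈α^aX : β ≈ α ^ᶠ (a * X)
    β≈α^aX = ·-cancelˡ g≉0 (begin
      g · β                  ≈⟨ *-comm g β ⟩
      β · g                  ≈⟨ βg≈g^qʲ ⟩
      g ^ᶠ (q ^ j)           ≈⟨ ^ᶠ-assoc α a (q ^ j) ⟩
      α ^ᶠ (a * q ^ j)       ≈⟨ ^ᶠ-congʳ α a*q^j≡a+a*X ⟩
      α ^ᶠ (a ℕ.+ a * X)     ≈⟨ ^ᶠ-homo-· α a (a * X) ⟩
      g · α ^ᶠ (a * X)       ∎)
    t≡aX : t ≡ a * X
    t≡aX = hasOrder-injective α-order t<N
             (subst (a * X <_) a*n≡N (ℕₚ.*-monoʳ-< a {{>-nonZero 0<a}} (q^j∸1<n 2≤q 0<h n*[q∸1]≡h*[qᵐ∸1] j<m)))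
             β≈α^aX

  minimalPolynomials-distinct : ¬ (q ≡ 3 × h ≡ 1 × e ≡ 2 × m ≡ 2) → ∀ (f₁ f₂ : Poly) →
                                IsMinimalPolynomial q x f₁ → IsMinimalPolynomial q y f₂ → ¬ Pointwise _≈_ f₁ f₂
  minimalPolynomials-distinct not-exceptional f₁ f₂ =
    minimalPolynomials-differ 0<m x^qᵐ≈x conjugate-injective (y≉conjugate not-exceptional)

mainTheorem1 : ∀ {c ℓ : Level} (F : FiniteField c ℓ) →
  let open FiniteField F renaming (_*_ to _·_)
      open FieldNotions F
  in (p s m : ℕ) → Prime p → 0 < s → 0 < m →
     FiniteField.size F ≡ (p ^ s) ^ m →
     (α : Carrier) → IsGenerator α →
     (h : ℕ) → 0 < h → h ∣ (p ^ s) ∸ 1 →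
     (e : ℕ) → 1 < e → e ∣ gcd ((p ^ s) ∸ 1) (h * m) →
     (a : ℕ) → a * h ≡ (p ^ s) ∸ 1 →
     (n : ℕ) → n * ((p ^ s) ∸ 1) ≡ h * (((p ^ s) ^ m) ∸ 1) →
     (t : ℕ) → t * e ≡ ((p ^ s) ^ m) ∸ 1 →
     HasOrder (α ^ᶠ a) n
     × (((α ^ᶠ a) · (α ^ᶠ t)) ^ᶠ n) ≈ 1#
     × (¬ ((p ^ s ≡ 3) × (h ≡ 1) × (e ≡ 2) × (m ≡ 2)) →
        ∀ (f₁ f₂ : Poly) →
        IsMinimalPolynomial (p ^ s) ((α ^ᶠ a) ⁻¹) f₁ →
        IsMinimalPolynomial (p ^ s) (((α ^ᶠ t) · (α ^ᶠ a)) ⁻¹) f₂ →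
        ¬ Pointwise _≈_ f₁ f₂)
mainTheorem1 F p s m p-prime 0<s 0<m size≡qᵐ α α-generator h 0<h h∣q∸1 e 1<e e∣gcd
             a a*h≡q∸1 n n*[q∸1]≡h*[qᵐ∸1] t t*e≡qᵐ∸1 =
  g-order , gβ^n≈1 , minimalPolynomials-distinct
  where
  open Setting F p s m p-prime 0<s 0<m size≡qᵐ α α-generator h 0<h h∣q∸1 e 1<e e∣gcd
               a a*h≡q∸1 n n*[q∸1]≡h*[qᵐ∸1] t t*e≡qᵐ∸1
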